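{- Let $n\ge1$ and let $T$ be a plane tree with $n$ vertices. Then: (1) the permutation $\gamma^{ -1}(\varepsilon(T))\in S_1\times S_{n-1}$ is $213$-avoiding, and (2) the permutation $\gamma^{ -1}(\omega(T))\in S_1\times S_{n-1}$ is $312$-avoiding.
   Context: $S_1\times S_{n-1}$ denotes the set of permutations $\alpha$ of $\{1,\dots,n\}$ with $\alpha(1)=1$, in one-line notation. An inversion of $\alpha$ is a pair of positions $(i,j)$ with $i<j$ and $\alpha(i)>\alpha(j)$; the first inversion from position $i$ is the inversion $(i,j)$ with minimal $j$. The first inversion tree $\gamma(\alpha)$ is the rooted tree on vertices labelled $1,\dots,n$ with root $1$ in which for each label $i\ne1$ the parent of $i$ is $j$ if $(\alpha^{ -1}(i),\alpha^{ -1}(j))$ is the first inversion from position $\alpha^{ -1}(i)$, and is $1$ if there is none; $\gamma$ is a bijection from $S_1\times S_{n-1}$ onto the set of increasing trees on labels $1,\dots,n$ (rooted trees with root $1$ and labels increasing from parent to child). A plane tree is a rooted tree with the children of every vertex linearly ordered left to right. The eastpush-labelling $\varepsilon(T)$: start with an empty stack and $i=1$; push the root labelling it $i$ and increment $i$; while the stack is nonempty, pop a vertex and for each child from left to right push it, labelling it $i$, and increment $i$. The westpop-labelling $\omega(T)$: start with the root on the stack and $i=1$; while the stack is nonempty, pop a vertex labelling it $i$, increment $i$, and push its children from right to left. Both labellings are increasing trees. $\alpha$ avoids $213$ (resp. $312$) if there are no positions $i<j<k$ with $\alpha(i),\alpha(j),\alpha(k)$ in the same relative order as $2,1,3$ (resp.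 $3,1,2$). -}

module Defs where

open import Data.Nat using (ℕ; zero; suc; _+_; _∸_; _<_; _<ᵇ_; _≡ᵇ_)
open import Data.Bool using (Bool; true; false; if_then_else_)
open import Data.List using (List; []; _∷_; map; upTo; drop; length; _++_)
open import Data.Product using (_×_; _,_; Σ)
open import Data.Empty using (⊥)
open import Relation.Binary.PropositionalEquality using (_≡_)
open import Relation.Nullary using (¬_)
open import Data.List.Relation.Binary.Permutation.Propositional using (_↭_)

-- Permutations in one-line notation: a list α = [α(1),…,α(n)].
-- Positions are 0-indexed internally.

-- value at (0-indexed) position p; 0 if out of range
at : List ℕ → ℕ → ℕ
at []       _       = 0
at (x ∷ xs) zero    = x
at (x ∷ xs) (suc p) = at xs p

-- (0-indexed) position of the first occurrence of value v, i.e. α⁻¹(v)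
pos : List ℕ → ℕ → ℕ
pos []       v = 0
pos (x ∷ xs) v = if x ≡ᵇ v then 0 else suc (pos xs v)

-- α is a permutation of {1,…,n} with α(1) = 1, i.e. α ∈ S₁ × S_{n-1}
InS1xS : ℕ → List ℕ → Set
InS1xS n α = (α ↭ map suc (upTo n)) × (at α 0 ≡ 1)

firstBelow : ℕ → List ℕ → ℕ
firstBelow i []       = 1
firstBelow i (x ∷ xs) = if x <ᵇ i then x else firstBelow i xs

labels2 : ℕ → List ℕ
labels2 n = map (λ k → 2 + k) (upTo (n ∸ 1))

-- A rooted tree on labels 1,…,n with root 1 is represented by its
-- parent list: the k-th entry is the parent of label k+2 (k = 0,…,n-2).

-- First inversion tree γ(α): parent of label i is the value α(j) where
-- (α⁻¹(i), j) is the first inversion from position α⁻¹(i), and 1 if none.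
gamma : List ℕ → List ℕ
gamma α = map (λ i → firstBelow i (drop (suc (pos α i)) α)) (labels2 (length α))

Avoids213 : List ℕ → Set
Avoids213 α = ∀ i j k → i < j → j < k → k < length α →
  ¬ ((at α j < at α i) × (at α i < at α k))

Avoids312 : List ℕ → Set
Avoids312 α = ∀ i j k → i < j → j < k → k < length α →
  ¬ ((at α j < at α k) × (at α k < at α i))

data PTree : Set where
  node : List PTree → PTree

mutual
  size : PTree → ℕ
  size (node cs) = suc (sizes cs)

  sizes : List PTree → ℕ
  sizes []       = 0
  sizes (c ∷ cs) = size c + sizes cs

parentOf : List (ℕ × ℕ) → ℕ → ℕ
parentOf []             i = 0
parentOf ((l , p) ∷ ps) i = if l ≡ᵇ i then p else parentOf ps i

toParentList : ℕ → List (ℕ × ℕ) → List ℕ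
toParentList n ps = map (parentOf ps) (labels2 n)

-- Eastpush labelling. Stack entries: (subtree , its label).
-- Pushing the children left to right, each labelled with the current counter.
pushEast : List PTree → ℕ → List (PTree × ℕ) → ℕ → List (ℕ × ℕ)
         → List (PTree × ℕ) × ℕ × List (ℕ × ℕ)
pushEast []       l st i acc = st , i , acc
pushEast (c ∷ cs) l st i acc = pushEast cs l ((c , i) ∷ st) (suc i) ((i , l) ∷ acc)

-- main loop, one pop per step; the fuel is the number of vertices
-- (each vertex is popped exactly once)
eastLoop : ℕ → List (PTree × ℕ) → ℕ → List (ℕ × ℕ) → List (ℕ × ℕ)
eastLoop zero    st                    i acc = acc
eastLoop (suc f) []                    i acc = acc
eastLoop (suc f) ((node cs , l) ∷ st)  i acc with pushEast cs l st i acc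
... | st' , i' , acc' = eastLoop f st' i' acc'

eastpush : PTree → List ℕ
eastpush T = toParentList (size T) (eastLoop (size T) ((T , 1) ∷ []) 2 [])

-- Stack entries: (subtree , label of its parent);
-- the root carries the dummy parent 0 (never looked up).
westLoop : ℕ → List (PTree × ℕ) → ℕ → List (ℕ × ℕ) → List (ℕ × ℕ)
westLoop zero    st                   i acc = acc
westLoop (suc f) []                   i acc = acc
westLoop (suc f) ((node cs , p) ∷ st) i acc =
  westLoop f (map (λ c → c , i) cs ++ st) (suc i) ((i , p) ∷ acc)

westpop : PTree → List ℕ
westpop T = toParentList (size T) (westLoop (size T) ((T , 0) ∷ []) 1 [])

-- "γ⁻¹(τ) satisfies P": γ⁻¹(τ) exists in S₁×S_{n-1}, and every preimage
-- (there is exactly one, γ being a bijection) satisfies P.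
GammaInvSatisfies : ℕ → List ℕ → (List ℕ → Set) → Set
GammaInvSatisfies n τ P =
  Σ (List ℕ) (λ α → InS1xS n α × (gamma α ≡ τ))
  × (∀ α → InS1xS n α → gamma α ≡ τ → P α)

-- γ⁻¹ of an increasing tree is obtained from the word 1 by inserting the labels
-- 2, 3, … in increasing order, each directly in front of its parent, or at the
-- end when the parent is the root.  The new label is the largest so far, so the
-- first smaller entry after it is its parent and no earlier first inversion
-- changes; deleting the largest label undoes the step, which gives uniqueness.
-- Under eastpush the labels on the stack form an increasing run and every new
-- label is inserted at the end of that run; under westpop the labels along the
-- current path to the root form a decreasing tail and every new label is
-- inserted at the start of a suffix of it.  A new maximum placed right after an
-- increasing prefix cannot create a 213, and one placed right before a
-- decreasing suffix cannot create a 312.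

module Submission where

open import Defs
open import Data.Bool using (true; false)
open import Data.Empty using (⊥-elim)
open import Data.List using (List; []; _∷_; _++_; _∷ʳ_; map; length; drop; upTo)
open import Data.List.Properties
  using ( ++-assoc; ++-identityʳ; map-++; map-applyUpTo; map-cong-local; upTo-∷ʳ; ∷-injective
        ; length-map; length-upTo)
open import Data.List.Membership.Propositional using (_∈_; _∉_)
open import Data.List.Membership.Propositional.Properties
  using (∈-++⁺ˡ; ∈-++⁺ʳ; ∈-++⁻; ∈-∃++; ∈-map⁻; ∈-upTo⁻)
open import Data.List.Relation.Unary.Any using (here; there)
open import Data.List.Relation.Unary.All as All using (All; []; _∷_)
import Data.List.Relation.Unary.All.Properties as All
open import Data.List.Relation.Unary.AllPairs using (AllPairs; []; _∷_)
import Data.List.Relation.Unary.AllPairs.Properties as AllPairs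
open import Data.List.Relation.Unary.Unique.Propositional using (Unique)
import Data.List.Relation.Unary.Unique.Propositional.Properties as Unique
open import Data.List.Relation.Binary.Permutation.Propositional
  using (_↭_; prep; ↭-refl; ↭-trans; ↭-sym; ↭-reflexive; ↭⇒↭ₛ; module PermutationReasoning)
open import Data.List.Relation.Binary.Permutation.Propositional.Properties
  using (shift; drop-mid; drop-∷; ∷↭∷ʳ; ∈-resp-↭; ↭-length; ↭-empty-inv)
import Data.List.Relation.Binary.Permutation.Setoid.Properties as Permutationₛ
open import Data.Nat using (ℕ; zero; suc; _+_; _<_; _≤_; _>_; _≥_; _≡ᵇ_; _<ᵇ_; pred; s≤s; z≤n)
open import Data.Nat.Properties
  using ( _≟_; _<?_; ≤-refl; ≤-trans; <⇒≤; <-trans; <-asym; <-irrefl; <⇒≱; <⇒≯; <⇒≢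
        ; +-assoc; +-identityʳ; +-suc; suc-injective; +-cancelˡ-≡)
open import Data.Nat.Tactic.RingSolver using (solve-∀)
open import Data.Product using (Σ-syntax; ∃₂; _×_; _,_; proj₁; proj₂)
open import Data.Sum using (inj₁; inj₂)
open import Function using (_∘_; _on_)
open import Relation.Binary.PropositionalEquality
open import Relation.Nullary using (¬_; yes; no)
open import Relation.Nullary.Decidable using (dec-true; dec-false)

≡ᵇ-refl : ∀ n → (n ≡ᵇ n) ≡ true
≡ᵇ-refl n = dec-true (n ≟ n) refl

≢⇒≡ᵇ≡false : ∀ {m n} → m ≢ n → (m ≡ᵇ n) ≡ false
≢⇒≡ᵇ≡false {m} {n} = dec-false (m ≟ n)

<⇒<ᵇ≡true : ∀ {m n} → m < n → (m <ᵇ n) ≡ true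
<⇒<ᵇ≡true {m} {n} = dec-true (m <? n)

≮⇒<ᵇ≡false : ∀ {m n} → ¬ m < n → (m <ᵇ n) ≡ false
≮⇒<ᵇ≡false {m} {n} = dec-false (m <? n)

map-≡⇒All-≡ : ∀ {f g : ℕ → ℕ} xs → map f xs ≡ map g xs → All (λ x → f x ≡ g x) xs
map-≡⇒All-≡ []       _  = []
map-≡⇒All-≡ (x ∷ xs) eq = proj₁ (∷-injective eq) ∷ map-≡⇒All-≡ xs (proj₂ (∷-injective eq))

AllPairs-++⁻ˡ : ∀ {R : ℕ → ℕ → Set} A {B} → AllPairs R (A ++ B) → AllPairs R A
AllPairs-++⁻ˡ []      _        = []
AllPairs-++⁻ˡ (_ ∷ A) (r ∷ rs) = All.++⁻ˡ A r ∷ AllPairs-++⁻ˡ A rs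

AllPairs-++⁻ʳ : ∀ {R : ℕ → ℕ → Set} A {B} → AllPairs R (A ++ B) → AllPairs R B
AllPairs-++⁻ʳ []      rs       = rs
AllPairs-++⁻ʳ (_ ∷ A) (_ ∷ rs) = AllPairs-++⁻ʳ A rs

AllPairs-∷ʳ⁺ : ∀ {R : ℕ → ℕ → Set} {A x} → AllPairs R A → All (λ a → R a x) A → AllPairs R (A ∷ʳ x)
AllPairs-∷ʳ⁺ rs ax = AllPairs.++⁺ rs ([] ∷ []) (All.map (_∷ []) ax)

AllPairs-before : ∀ {R : ℕ → ℕ → Set} A {y B} → AllPairs R (A ++ y ∷ B) → All (λ a → R a y) A
AllPairs-before []      _        = []
AllPairs-before (_ ∷ A) (r ∷ rs) = All.head (All.++⁻ʳ A r) ∷ AllPairs-before A rs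

Unique-resp-↭ : ∀ {xs ys : List ℕ} → xs ↭ ys → Unique xs → Unique ys
Unique-resp-↭ = Permutationₛ.Unique-resp-↭ (setoid ℕ) ∘ ↭⇒↭ₛ

-- Inverting γ by insertion

labels2-∷ʳ : ∀ m → labels2 (2 + m) ≡ labels2 (suc m) ∷ʳ (2 + m)
labels2-∷ʳ m = trans (cong (map (2 +_)) (sym (upTo-∷ʳ m))) (map-++ (2 +_) (upTo m) (m ∷ []))

∈-labels2⁻ : ∀ {m i} → i ∈ labels2 (suc m) → 2 ≤ i × i < 2 + m
∈-labels2⁻ i∈ with ∈-map⁻ (2 +_) i∈
... | j , j∈ , refl = s≤s (s≤s z≤n) , s≤s (s≤s (∈-upTo⁻ j∈))

∈-labels2-∷ʳ : ∀ {m i} → i ∈ labels2 (suc m) → i ∈ labels2 (2 + m)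
∈-labels2-∷ʳ {m} i∈ = subst (_ ∈_) (sym (labels2-∷ʳ m)) (∈-++⁺ˡ i∈)

2+m∈labels2 : ∀ m → 2 + m ∈ labels2 (2 + m)
2+m∈labels2 m = subst (2 + m ∈_) (sym (labels2-∷ʳ m)) (∈-++⁺ʳ (labels2 (suc m)) (here refl))

map-suc-upTo-suc : ∀ m → map suc (upTo (suc m)) ≡ 1 ∷ labels2 (suc m)
map-suc-upTo-suc m = cong (1 ∷_) (trans (map-applyUpTo _ suc m) (sym (map-applyUpTo _ (2 +_) m)))

↭labels2⇒length : ∀ {m w} → w ↭ labels2 (suc m) → length w ≡ m
↭labels2⇒length {m} w↭ = trans (↭-length w↭) (trans (length-map (2 +_) (upTo m)) (length-upTo m))

↭labels2⇒bounds : ∀ {m w} → w ↭ labels2 (suc m) → All (λ y → 2 ≤ y × y < 2 + m) w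
↭labels2⇒bounds w↭ = All.tabulate (∈-labels2⁻ ∘ ∈-resp-↭ w↭)

↭labels2⇒< : ∀ {m w} → w ↭ labels2 (suc m) → All (_< 2 + m) (1 ∷ w)
↭labels2⇒< w↭ = s≤s (s≤s z≤n) ∷ All.map proj₂ (↭labels2⇒bounds w↭)

↭labels2⇒Unique : ∀ {m w} → w ↭ labels2 (suc m) → Unique w
↭labels2⇒Unique {m} w↭ = Unique-resp-↭ (↭-sym w↭) (Unique.map⁺ (+-cancelˡ-≡ 2 _ _) (Unique.upTo⁺ m))

InS1xS-∷ : ∀ {m w} → w ↭ labels2 (suc m) → InS1xS (suc m) (1 ∷ w)
InS1xS-∷ {m} w↭ = ↭-trans (prep 1 w↭) (↭-reflexive (sym (map-suc-upTo-suc m))) , refl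

InS1xS⁻ : ∀ {m α} → InS1xS (suc m) α → Σ[ v ∈ List ℕ ] α ≡ 1 ∷ v × v ↭ labels2 (suc m)
InS1xS⁻ {α = []}    (_ , ())
InS1xS⁻ {m} {α = _ ∷ v} (α↭ , refl) = v , refl , drop-∷ (↭-trans α↭ (↭-reflexive (map-suc-upTo-suc m)))

-- A new label whose parent is p is placed directly in front of L.
data ParentSuffix : ℕ → List ℕ → Set where
  rootEnd     : ParentSuffix 1 []
  parentFirst : ∀ {p} L → ParentSuffix p (p ∷ L)

parentSuffix-∈ : ∀ {p L} A → ParentSuffix p L → p ∈ 1 ∷ A ++ L
parentSuffix-∈ A rootEnd         = here refl
parentSuffix-∈ A (parentFirst L) = there (∈-++⁺ʳ A (here refl))

firstBelow-parentSuffix : ∀ {x p L} → p < x → ParentSuffix p L → firstBelow x L ≡ p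
firstBelow-parentSuffix _   rootEnd         = refl
firstBelow-parentSuffix p<x (parentFirst L) rewrite <⇒<ᵇ≡true p<x = refl

parentSuffix-firstBelow : ∀ {x L} → All (_< x) L → ParentSuffix (firstBelow x L) L
parentSuffix-firstBelow []                    = rootEnd
parentSuffix-firstBelow {L = _ ∷ L} (y<x ∷ _) rewrite <⇒<ᵇ≡true y<x = parentFirst L

parentSuffix-∉ : ∀ {m p} A {L} → A ++ L ↭ labels2 (suc m) → ParentSuffix p L → p ∉ A
parentSuffix-∉ A w↭ rootEnd 1∈A = <-irrefl refl (proj₁ (All.lookup (↭labels2⇒bounds w↭) (∈-++⁺ˡ 1∈A)))
parentSuffix-∉ A w↭ (parentFirst L) p∈A =
  Unique.Unique[x∷xs]⇒x∉xs (Unique-resp-↭ (shift _ A L) (↭labels2⇒Unique w↭)) (∈-++⁺ˡ p∈A)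

++-cancel-parentSuffix : ∀ {p L R} A B → p ∉ A → p ∉ B → ParentSuffix p L → ParentSuffix p R →
                         A ++ L ≡ B ++ R → A ≡ B × L ≡ R
++-cancel-parentSuffix []      []      _   _   _               _               eq   = refl , eq
++-cancel-parentSuffix []      (_ ∷ _) _   p∉B (parentFirst _) _               refl = ⊥-elim (p∉B (here refl))
++-cancel-parentSuffix (_ ∷ _) []      p∉A _   _               (parentFirst _) refl = ⊥-elim (p∉A (here refl))
++-cancel-parentSuffix (_ ∷ A) (_ ∷ B) p∉A p∉B psL psR eq with refl , eq′ ← ∷-injective eq
  with refl , L≡R ← ++-cancel-parentSuffix A B (p∉A ∘ there) (p∉B ∘ there) psL psR eq′ = refl , L≡R

gammaParent : List ℕ → ℕ → ℕ
gammaParent α i = firstBelow i (drop (suc (pos α i)) α)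

gammaParent-head : ∀ i w → gammaParent (i ∷ w) i ≡ firstBelow i w
gammaParent-head i w rewrite ≡ᵇ-refl i = refl

gammaParent-∷ : ∀ {a i} w → a ≢ i → gammaParent (a ∷ w) i ≡ gammaParent w i
gammaParent-∷ w a≢i rewrite ≢⇒≡ᵇ≡false a≢i = refl

firstBelow-remove : ∀ {i x} A {L} → i < x → firstBelow i (A ++ x ∷ L) ≡ firstBelow i (A ++ L)
firstBelow-remove [] i<x rewrite ≮⇒<ᵇ≡false (<⇒≯ i<x) = refl
firstBelow-remove {i} (a ∷ A) i<x with a <ᵇ i
... | true  = refl
... | false = firstBelow-remove A i<x

gammaParent-remove : ∀ {i x} A {L} → i < x → gammaParent (A ++ x ∷ L) i ≡ gammaParent (A ++ L) i
gammaParent-remove []          i<x = gammaParent-∷ _ (<⇒≢ i<x ∘ sym)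
gammaParent-remove {i} (a ∷ A) i<x with a ≡ᵇ i
... | true  = firstBelow-remove A i<x
... | false = gammaParent-remove A i<x

gammaParent-insert : ∀ {x} A {L} → x ∉ A → gammaParent (A ++ x ∷ L) x ≡ firstBelow x L
gammaParent-insert {x} [] {L} _ = gammaParent-head x L
gammaParent-insert (a ∷ A) x∉A =
  trans (gammaParent-∷ _ (x∉A ∘ here ∘ sym)) (gammaParent-insert A (x∉A ∘ there))

parentOf-head : ∀ l p log → parentOf ((l , p) ∷ log) l ≡ p
parentOf-head l p log rewrite ≡ᵇ-refl l = refl

parentOf-∷ : ∀ {l i} p log → l ≢ i → parentOf ((l , p) ∷ log) i ≡ parentOf log i
parentOf-∷ p log l≢i rewrite ≢⇒≡ᵇ≡false l≢i = refl

ParentsMatch : List (ℕ × ℕ) → ℕ → List ℕ → Set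
ParentsMatch log m α = ∀ {i} → i ∈ labels2 (suc m) → gammaParent α i ≡ parentOf log i

gamma-≡-toParentList : ∀ {log m} α → length α ≡ suc m → ParentsMatch log m α →
                       gamma α ≡ toParentList (suc m) log
gamma-≡-toParentList α len match =
  trans (cong (map (gammaParent α) ∘ labels2) len) (map-cong-local (All.tabulate match))

gamma-≡⇒ParentsMatch : ∀ {log m} α → length α ≡ suc m → gamma α ≡ toParentList (suc m) log →
                       ParentsMatch log m α
gamma-≡⇒ParentsMatch {m = m} α len eq = All.lookup (map-≡⇒All-≡ (labels2 (suc m)) eq′)
  where eq′ = trans (cong (map (gammaParent α) ∘ labels2) (sym len)) eq

-- w arranges the labels 2, …, suc m, and 1 ∷ w is γ⁻¹ of the tree recorded in
-- log as (label , parent) pairs.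
data Grown : List (ℕ × ℕ) → ℕ → List ℕ → Set where
  start : ∀ {log} → Grown log 0 []
  grow  : ∀ {log m p} A L → Grown log m (A ++ L) → ParentSuffix p L →
          Grown ((2 + m , p) ∷ log) (suc m) (A ++ 2 + m ∷ L)

grown-↭ : ∀ {log m w} → Grown log m w → w ↭ labels2 (suc m)
grown-↭ start = ↭-refl
grown-↭ (grow {m = m} A L g _) = begin
  A ++ x ∷ L             ↭⟨ shift x A L ⟩
  x ∷ A ++ L             ↭⟨ prep x (grown-↭ g) ⟩
  x ∷ labels2 (suc m)    ↭⟨ ∷↭∷ʳ x (labels2 (suc m)) ⟩
  labels2 (suc m) ∷ʳ x   ≡⟨ sym (labels2-∷ʳ m) ⟩
  labels2 (2 + m)        ∎
  where
  open PermutationReasoning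
  x = 2 + m

grown-< : ∀ {log m w} → Grown log m w → All (_< 2 + m) (1 ∷ w)
grown-< = ↭labels2⇒< ∘ grown-↭

grown-parents : ∀ {log m w} → Grown log m w → ParentsMatch log m (1 ∷ w)
grown-parents start ()
grown-parents (grow {log} {m} {p} A L g ps) {i} i∈
  with ∈-++⁻ (labels2 (suc m)) (subst (i ∈_) (labels2-∷ʳ m) i∈)
... | inj₁ i∈′ = begin
  gammaParent (1 ∷ A ++ 2 + m ∷ L) i ≡⟨ gammaParent-remove (1 ∷ A) i<x ⟩
  gammaParent (1 ∷ A ++ L) i         ≡⟨ grown-parents g i∈′ ⟩
  parentOf log i                     ≡⟨ parentOf-∷ p log (<⇒≢ i<x ∘ sym) ⟨
  parentOf ((2 + m , p) ∷ log) i     ∎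
  where
  open ≡-Reasoning
  i<x = proj₂ (∈-labels2⁻ i∈′)
... | inj₂ (here refl) = begin
  gammaParent (1 ∷ A ++ 2 + m ∷ L) (2 + m) ≡⟨ gammaParent-insert (1 ∷ A) x∉ ⟩
  firstBelow (2 + m) L                     ≡⟨ firstBelow-parentSuffix p<x ps ⟩
  p                                        ≡⟨ parentOf-head (2 + m) p log ⟨
  parentOf ((2 + m , p) ∷ log) (2 + m)     ∎
  where
  open ≡-Reasoning
  x∉ : 2 + m ∉ 1 ∷ A
  x∉ x∈ = <-irrefl refl (All.lookup (grown-< g) (∈-++⁺ˡ x∈))
  p<x = All.lookup (grown-< g) (parentSuffix-∈ A ps)

grown-unique : ∀ {log m w v} → Grown log m w → v ↭ labels2 (suc m) → ParentsMatch log m (1 ∷ v) → v ≡ w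
grown-unique start v↭ _ = ↭-empty-inv v↭
grown-unique (grow {log} {m} {p} A L g ps) v↭ match
  with ∈-∃++ (∈-resp-↭ (↭-sym v↭) (2+m∈labels2 m))
... | u , r , refl = cong₂ (λ B R → B ++ 2 + m ∷ R) (proj₁ u≡A×r≡L) (proj₂ u≡A×r≡L)
  where
  open ≡-Reasoning
  x = 2 + m
  u++r↭ : u ++ r ↭ labels2 (suc m)
  u++r↭ = ↭-trans (drop-mid u (labels2 (suc m)) (↭-trans v↭ (↭-reflexive (labels2-∷ʳ m))))
                  (↭-reflexive (++-identityʳ _))
  below : All (_< x) (1 ∷ u ++ r)
  below = ↭labels2⇒< u++r↭
  match′ : ParentsMatch log m (1 ∷ u ++ r)
  match′ {i} i∈ = begin
    gammaParent (1 ∷ u ++ r) i     ≡⟨ gammaParent-remove (1 ∷ u) i<x ⟨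
    gammaParent (1 ∷ u ++ x ∷ r) i ≡⟨ match (∈-labels2-∷ʳ i∈) ⟩
    parentOf ((x , p) ∷ log) i     ≡⟨ parentOf-∷ p log (<⇒≢ i<x ∘ sym) ⟩
    parentOf log i                 ∎
    where i<x = proj₂ (∈-labels2⁻ i∈)
  x∉ : x ∉ 1 ∷ u
  x∉ x∈ = <-irrefl refl (All.lookup below (∈-++⁺ˡ x∈))
  firstBelow≡p : firstBelow x r ≡ p
  firstBelow≡p = begin
    firstBelow x r                 ≡⟨ gammaParent-insert (1 ∷ u) x∉ ⟨
    gammaParent (1 ∷ u ++ x ∷ r) x ≡⟨ match (2+m∈labels2 m) ⟩
    parentOf ((x , p) ∷ log) x     ≡⟨ parentOf-head x p log ⟩
    p                              ∎
  ps′ : ParentSuffix p r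
  ps′ = subst (λ q → ParentSuffix q r) firstBelow≡p (parentSuffix-firstBelow (All.++⁻ʳ u (All.tail below)))
  u≡A×r≡L : u ≡ A × r ≡ L
  u≡A×r≡L = ++-cancel-parentSuffix u A (parentSuffix-∉ u u++r↭ ps′) (parentSuffix-∉ A (grown-↭ g) ps) ps′ ps
              (grown-unique g u++r↭ match′)

grown⇒GammaInvSatisfies : ∀ (P : List ℕ → Set) {log m} → Σ[ w ∈ List ℕ ] Grown log m w × P (1 ∷ w) →
                          GammaInvSatisfies (suc m) (toParentList (suc m) log) P
grown⇒GammaInvSatisfies P {log} {m} (w , g , Pw) = (1 ∷ w , InS1xS-∷ w↭ , γw) , only
  where
  w↭ = grown-↭ g
  γw : gamma (1 ∷ w) ≡ toParentList (suc m) log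
  γw = gamma-≡-toParentList {log} (1 ∷ w) (cong suc (↭labels2⇒length w↭)) (grown-parents g)
  only : ∀ α → InS1xS (suc m) α → gamma α ≡ toParentList (suc m) log → P α
  only α α∈ γα with InS1xS⁻ α∈
  ... | v , refl , v↭ = subst (P ∘ (1 ∷_)) (sym v≡w) Pw
    where
    v≡w : v ≡ w
    v≡w = grown-unique g v↭ (gamma-≡⇒ParentsMatch {log} (1 ∷ v) (cong suc (↭labels2⇒length v↭)) γα)

-- Inserting a new maximum

Avoids : (ℕ → ℕ → ℕ → Set) → List ℕ → Set
Avoids Pat α = ∀ i j k → i < j → j < k → k < length α → ¬ Pat (at α i) (at α j) (at α k)

Pattern213 Pattern312 : ℕ → ℕ → ℕ → Set
Pattern213 a b c = b < a × a < c
Pattern312 a b c = b < c × c < a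

avoids-singleton : ∀ Pat x → Avoids Pat (x ∷ [])
avoids-singleton _ _ _ _ zero    _ ()
avoids-singleton _ _ _ _ (suc _) _ _ (s≤s ())

All-at : ∀ {P : ℕ → Set} {α} → All P α → ∀ {i} → i < length α → P (at α i)
All-at (px ∷ _)   {zero}  _        = px
All-at (_  ∷ pxs) {suc i} (s≤s i<) = All-at pxs i<

at-++ˡ : ∀ P {Z i} → i < length P → at (P ++ Z) i ≡ at P i
at-++ˡ (_ ∷ P) {i = zero}  _        = refl
at-++ˡ (_ ∷ P) {i = suc i} (s≤s i<) = at-++ˡ P i<

at-insert : ∀ P {x Q} → at (P ++ x ∷ Q) (length P) ≡ x
at-insert []      = refl
at-insert (_ ∷ P) = at-insert P

AllPairs-at : ∀ {R : ℕ → ℕ → Set} {Z i j} → AllPairs R Z → i < j → j < length Z → R (at Z i) (at Z j)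
AllPairs-at {i = zero}  {suc j} (r ∷ _)  _          (s≤s j<) = All-at r j<
AllPairs-at {i = suc i} {suc j} (_ ∷ rs) (s≤s i<j) (s≤s j<) = AllPairs-at rs i<j j<

AllPairs-at-++ˡ : ∀ {R : ℕ → ℕ → Set} P {Z i j} → AllPairs R P → i < j → j < length P →
                  R (at (P ++ Z) i) (at (P ++ Z) j)
AllPairs-at-++ˡ {R} P rs i<j j< =
  subst₂ R (sym (at-++ˡ P (<-trans i<j j<))) (sym (at-++ˡ P j<)) (AllPairs-at rs i<j j<)

AllPairs-at-++ʳ : ∀ {R : ℕ → ℕ → Set} P {Z i j} → AllPairs R Z →
                  length P ≤ i → i < j → j < length (P ++ Z) → R (at (P ++ Z) i) (at (P ++ Z) j)
AllPairs-at-++ʳ []      rs _        i<j j<                         = AllPairs-at rs i<j j<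
AllPairs-at-++ʳ (_ ∷ P) rs (s≤s le) (s≤s i<j) (s≤s j<) = AllPairs-at-++ʳ P rs le i<j j<

-- Data.Fin.punchOut on ℕ positions.
punchOut : ℕ → ℕ → ℕ
punchOut zero    n       = pred n
punchOut (suc m) zero    = zero
punchOut (suc m) (suc n) = suc (punchOut m n)

at-punchOut : ∀ P {x Q n} → n ≢ length P → at (P ++ x ∷ Q) n ≡ at (P ++ Q) (punchOut (length P) n)
at-punchOut []      {n = zero}  n≢ = ⊥-elim (n≢ refl)
at-punchOut []      {n = suc n} _  = refl
at-punchOut (_ ∷ P) {n = zero}  _  = refl
at-punchOut (_ ∷ P) {n = suc n} n≢ = at-punchOut P (n≢ ∘ cong suc)

punchOut-mono : ∀ {m a b} → a ≢ m → b ≢ m → a < b → punchOut m a < punchOut m b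
punchOut-mono {zero}  {zero}          a≢ _  _         = ⊥-elim (a≢ refl)
punchOut-mono {zero}  {suc a} {suc b} _  _  (s≤s a<b) = a<b
punchOut-mono {suc m} {zero}  {suc b} _  _  _         = s≤s z≤n
punchOut-mono {suc m} {suc a} {suc b} a≢ b≢ (s≤s a<b) =
  s≤s (punchOut-mono (a≢ ∘ cong suc) (b≢ ∘ cong suc) a<b)

punchOut-< : ∀ (P : List ℕ) {x : ℕ} {Q n} → n ≢ length P → n < length (P ++ x ∷ Q) →
             punchOut (length P) n < length (P ++ Q)
punchOut-< []      {n = zero}  n≢ _        = ⊥-elim (n≢ refl)
punchOut-< []      {n = suc n} _  (s≤s n<) = n<
punchOut-< (_ ∷ P) {n = zero}  _  _        = s≤s z≤n
punchOut-< (_ ∷ P) {n = suc n} n≢ (s≤s n<) = s≤s (punchOut-< P (n≢ ∘ cong suc) n<)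

avoids-punchOut : ∀ Pat P Q {x} → Avoids Pat (P ++ Q) → ∀ {i j k} → i < j → j < k → k < length (P ++ x ∷ Q) →
                  i ≢ length P → j ≢ length P → k ≢ length P →
                  ¬ Pat (at (P ++ x ∷ Q) i) (at (P ++ x ∷ Q) j) (at (P ++ x ∷ Q) k)
avoids-punchOut Pat P Q {x} av i<j j<k k< i≢ j≢ k≢
  rewrite at-punchOut P {x} {Q} i≢ | at-punchOut P {x} {Q} j≢ | at-punchOut P {x} {Q} k≢ =
  av _ _ _ (punchOut-mono i≢ j≢ i<j) (punchOut-mono j≢ k≢ j<k) (punchOut-< P {x} {Q} k≢ k<)

insertMax-maximal : ∀ P Q {x n} → All (_< x) (P ++ Q) → n < length (P ++ x ∷ Q) →
                    ¬ at (P ++ x ∷ Q) (length P) < at (P ++ x ∷ Q) n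
insertMax-maximal P Q {x} {n} below n< x< =
  <⇒≱ (subst (_< at (P ++ x ∷ Q) n) (at-insert P) x<) (All-at ≤x n<)
  where
  ≤x : All (_≤ x) (P ++ x ∷ Q)
  ≤x = All.++⁺ (All.map <⇒≤ (All.++⁻ˡ P below)) (≤-refl ∷ All.map <⇒≤ (All.++⁻ʳ P below))

avoids213-insertMax : ∀ P Q {x} → AllPairs _<_ P → All (_< x) (P ++ Q) → Avoids213 (P ++ Q) →
                      Avoids213 (P ++ x ∷ Q)
avoids213-insertMax P Q inc below av i j k i<j j<k k< (aj<ai , ai<ak) with k ≟ length P
... | yes refl = <-asym aj<ai (AllPairs-at-++ˡ P inc i<j j<k)
... | no k≢ with i ≟ length P
...   | yes refl = insertMax-maximal P Q below k< ai<ak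
...   | no i≢ with j ≟ length P
...     | yes refl = insertMax-maximal P Q below (<-trans i<j (<-trans j<k k<)) aj<ai
...     | no j≢ = avoids-punchOut Pattern213 P Q av i<j j<k k< i≢ j≢ k≢ (aj<ai , ai<ak)

avoids312-insertMax : ∀ P Q {x} → AllPairs _>_ Q → All (_< x) (P ++ Q) → Avoids312 (P ++ Q) →
                      Avoids312 (P ++ x ∷ Q)
avoids312-insertMax P Q dec below av i j k i<j j<k k< (aj<ak , ak<ai) with i ≟ length P
... | yes refl = <-asym aj<ak (AllPairs-at-++ʳ P (All.++⁻ʳ P below ∷ dec) (<⇒≤ i<j) j<k k<)
... | no i≢ with j ≟ length P
...   | yes refl = insertMax-maximal P Q below k< aj<ak
...   | no j≢ with k ≟ length P
...     | yes refl = insertMax-maximal P Q below (<-trans i<j (<-trans j<k k<)) ak<ai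
...     | no k≢ = avoids-punchOut Pattern312 P Q av i<j j<k k< i≢ j≢ k≢ (aj<ak , ak<ai)

-- The eastpush labelling

stackSize : List (PTree × ℕ) → ℕ
stackSize []             = 0
stackSize ((t , _) ∷ st) = size t + stackSize st

stackLabels : List (PTree × ℕ) → List ℕ
stackLabels []             = []
stackLabels ((_ , l) ∷ st) = stackLabels st ∷ʳ l

descendants : List (PTree × ℕ) → ℕ
descendants []                   = 0
descendants ((node cs , _) ∷ st) = sizes cs + descendants st

-- The labels on the eastpush stack, read bottom to top, form an increasing run
-- of the permutation, directly followed by the rest R.
record EastInvariant (m : ℕ) (log : List (ℕ × ℕ)) (st : List (PTree × ℕ)) (R : List ℕ) : Set where
  field
    grown      : Grown log m (stackLabels st ++ R)
    increasing : AllPairs _<_ (1 ∷ stackLabels st)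
    avoids     : Avoids213 (1 ∷ stackLabels st ++ R)

eastInvariant-start : EastInvariant 0 [] [] []
eastInvariant-start = record
  { grown = start ; increasing = [] ∷ [] ; avoids = avoids-singleton Pattern213 1 }

eastInvariant-pop : ∀ {m log t l st R} → EastInvariant m log ((t , l) ∷ st) R → EastInvariant m log st (l ∷ R)
eastInvariant-pop {l = l} {st} {R} inv = record
  { grown      = subst (Grown _ _) assoc grown
  ; increasing = AllPairs-++⁻ˡ (1 ∷ stackLabels st) increasing
  ; avoids     = subst (Avoids213 ∘ (1 ∷_)) assoc avoids
  }
  where
  open EastInvariant inv
  assoc = ++-assoc (stackLabels st) (l ∷ []) R

eastInvariant-push : ∀ {m log st l L} c → ParentSuffix l L → EastInvariant m log st L →
                     EastInvariant (suc m) ((2 + m , l) ∷ log) ((c , 2 + m) ∷ st) L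
eastInvariant-push {m} {st = st} {L = L} c ps inv = record
  { grown      = subst (Grown _ _) assoc (grow A L grown ps)
  ; increasing = AllPairs-∷ʳ⁺ increasing (All.++⁻ˡ (1 ∷ A) below)
  ; avoids     = subst (Avoids213 ∘ (1 ∷_)) assoc (avoids213-insertMax (1 ∷ A) L increasing below avoids)
  }
  where
  open EastInvariant inv
  A = stackLabels st
  assoc = sym (++-assoc A (2 + m ∷ []) L)
  below = grown-< grown

EastPushed : List ℕ → List (PTree × ℕ) × ℕ × List (ℕ × ℕ) → Set
EastPushed L (st , i , log) = Σ[ m ∈ ℕ ] i ≡ 2 + m × EastInvariant m log st L

pushEast-invariant : ∀ cs {l m log st L} → ParentSuffix l L → EastInvariant m log st L →
                     EastPushed L (pushEast cs l st (2 + m) log)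
pushEast-invariant []       _  inv = _ , refl , inv
pushEast-invariant (c ∷ cs) ps inv = pushEast-invariant cs ps (eastInvariant-push c ps inv)

pushEast-descendants : ∀ cs l st i log → let st′ , i′ , _ = pushEast cs l st i log in
                       i′ + descendants st′ ≡ i + (sizes cs + descendants st)
pushEast-descendants []             l st i log = refl
pushEast-descendants (node ds ∷ cs) l st i log =
  trans (pushEast-descendants cs l ((node ds , i) ∷ st) (suc i) ((i , l) ∷ log))
        (regroup i (sizes ds) (sizes cs) (descendants st))
  where
  regroup : ∀ i a b d → suc i + (b + (a + d)) ≡ i + (suc a + b + d)
  regroup = solve-∀

pushEast-stackSize : ∀ cs l st i log → stackSize (proj₁ (pushEast cs l st i log)) ≡ sizes cs + stackSize st
pushEast-stackSize []       l st i log = refl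
pushEast-stackSize (c ∷ cs) l st i log =
  trans (pushEast-stackSize cs l ((c , i) ∷ st) (suc i) ((i , l) ∷ log))
        (regroup (size c) (sizes cs) (stackSize st))
  where
  regroup : ∀ a b s → b + (a + s) ≡ a + b + s
  regroup = solve-∀

-- The fuel f counts the vertices in the stacked subtrees, and the vertices
-- still unlabelled are exactly the proper descendants of stacked ones.
eastLoop-invariant : ∀ f st {n m log R} → EastInvariant m log st R →
                     f ≡ stackSize st → m + descendants st ≡ n →
                     Σ[ w ∈ List ℕ ] Grown (eastLoop f st (2 + m) log) n w × Avoids213 (1 ∷ w)
eastLoop-invariant zero [] {m = m} {R = R} inv _ count =
  R , subst (λ k → Grown _ k R) (trans (sym (+-identityʳ m)) count) grown , avoids
  where open EastInvariant inv
eastLoop-invariant zero    ((node _ , _) ∷ _) _ () _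
eastLoop-invariant (suc f) []                 _ () _
eastLoop-invariant (suc f) ((node cs , l) ∷ st) {m = m} {log} {R} inv fuel count
  with pushEast cs l st (2 + m) log
     | pushEast-invariant cs (parentFirst R) (eastInvariant-pop inv)
     | pushEast-descendants cs l st (2 + m) log
     | pushEast-stackSize cs l st (2 + m) log
... | st′ , _ , _ | _ , refl , inv′ | count′ | size′ =
  eastLoop-invariant f st′ inv′ (trans (suc-injective fuel) (sym size′))
    (suc-injective (suc-injective (trans count′ (cong (2 +_) count))))

-- The first iteration pops the root, whose label 1 heads the permutation
-- instead of joining the stack run.
eastpush-grown : ∀ cs → Σ[ w ∈ List ℕ ] Grown (eastLoop (size (node cs)) ((node cs , 1) ∷ []) 2 []) (sizes cs) w
                                         × Avoids213 (1 ∷ w)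
eastpush-grown cs
  with pushEast cs 1 [] 2 []
     | pushEast-invariant cs rootEnd eastInvariant-start
     | pushEast-descendants cs 1 [] 2 []
     | pushEast-stackSize cs 1 [] 2 []
... | st , _ , _ | _ , refl , inv | count | size′ =
  eastLoop-invariant (sizes cs) st inv (sym (trans size′ (+-identityʳ _)))
    (trans (suc-injective (suc-injective count)) (+-identityʳ _))

-- The westpop labelling

pushed : ℕ → List PTree → List (PTree × ℕ) → List (PTree × ℕ)
pushed x cs st = map (λ c → c , x) cs ++ st

stackSize-pushed : ∀ x cs st → stackSize (pushed x cs st) ≡ sizes cs + stackSize st
stackSize-pushed x []       st = refl
stackSize-pushed x (c ∷ cs) st =
  trans (cong (size c +_) (stackSize-pushed x cs st)) (sym (+-assoc (size c) (sizes cs) (stackSize st)))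

All-pushed : ∀ {P : PTree × ℕ → Set} {x} cs {st} → (∀ c → P (c , x)) → All P st → All P (pushed x cs st)
All-pushed []       _  Pst = Pst
All-pushed (c ∷ cs) Pc Pst = Pc c ∷ All-pushed cs Pc Pst

AllPairs-pushed : ∀ {x} cs {st} → AllPairs (_≥_ on proj₂) st → All ((_≤ x) ∘ proj₂) st →
                  AllPairs (_≥_ on proj₂) (pushed x cs st)
AllPairs-pushed []       sorted _  = sorted
AllPairs-pushed (c ∷ cs) sorted ≤x = All-pushed cs (λ _ → ≤-refl) ≤x ∷ AllPairs-pushed cs sorted ≤x

-- Entries on the westpop stack carry the label of their parent.  The word is
-- R ++ D with D decreasing, and the parents on the stack, which decrease from
-- top to bottom, all lie in 1 ∷ D.
record WestInvariant (m : ℕ) (log : List (ℕ × ℕ)) (st : List (PTree × ℕ)) (R D : List ℕ) : Set where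
  constructor westInvariant
  field
    grown      : Grown log m (R ++ D)
    decreasing : AllPairs _>_ D
    parentsIn  : All ((_∈ 1 ∷ D) ∘ proj₂) st
    descending : AllPairs (_≥_ on proj₂) st
    avoids     : Avoids312 (1 ∷ R ++ D)

splitAtParent : ∀ {p D} → p ∈ 1 ∷ D → AllPairs _>_ D → All (1 <_) D →
                ∃₂ λ D₁ L → D ≡ D₁ ++ L × ParentSuffix p L × All (p <_) D₁
splitAtParent {D = D} (here refl) _ D>1 = D , [] , sym (++-identityʳ D) , rootEnd , D>1
splitAtParent (there p∈D) dec _ with ∈-∃++ p∈D
... | D₁ , L , refl = D₁ , _ ∷ L , refl , parentFirst L , AllPairs-before D₁ dec

westInvariant-pop : ∀ {m log cs p st R D} → WestInvariant m log ((node cs , p) ∷ st) R D →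
                    ∃₂ λ R′ D′ → WestInvariant (suc m) ((2 + m , p) ∷ log) (pushed (2 + m) cs st) R′ D′
westInvariant-pop {m} {log} {cs} {p} {st} {R} (westInvariant g dec (p∈ ∷ parentsIn) (p≥ ∷ desc) av)
  with splitAtParent p∈ dec (All.map proj₁ (All.++⁻ʳ R (↭labels2⇒bounds (grown-↭ g))))
... | D₁ , L , refl , ps , D₁>p =
  R ++ D₁ , x ∷ L ,
  westInvariant (grow (R ++ D₁) L (subst (Grown log m) assoc g) ps)
                (All.++⁻ʳ (1 ∷ R ++ D₁) below ∷ AllPairs-++⁻ʳ D₁ dec)
                (All-pushed cs (λ _ → there (here refl)) (All.zipWith keep (parentsIn , p≥)))
                (AllPairs-pushed cs desc (All.map (λ q≤p → ≤-trans q≤p (<⇒≤ p<x)) p≥))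
                (avoids312-insertMax (1 ∷ R ++ D₁) L (AllPairs-++⁻ʳ D₁ dec) below
                  (subst (Avoids312 ∘ (1 ∷_)) assoc av))
  where
  x = 2 + m
  assoc = sym (++-assoc R D₁ L)
  below : All (_< x) (1 ∷ (R ++ D₁) ++ L)
  below = subst (All (_< x) ∘ (1 ∷_)) assoc (grown-< g)
  p<x : p < x
  p<x = All.lookup below (parentSuffix-∈ (R ++ D₁) ps)
  keep : ∀ {q} → q ∈ 1 ∷ D₁ ++ L × q ≤ p → q ∈ 1 ∷ x ∷ L
  keep (here q≡1 , _) = here q≡1
  keep (there q∈ , q≤p) with ∈-++⁻ D₁ q∈
  ... | inj₁ q∈D₁ = ⊥-elim (<⇒≱ (All.lookup D₁>p q∈D₁) q≤p)
  ... | inj₂ q∈L  = there (there q∈L)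

-- The vertices still unlabelled are exactly those of the stacked subtrees.
westLoop-invariant : ∀ f st {n m log R D} → WestInvariant m log st R D →
                     f ≡ stackSize st → m + stackSize st ≡ n →
                     Σ[ w ∈ List ℕ ] Grown (westLoop f st (2 + m) log) n w × Avoids312 (1 ∷ w)
westLoop-invariant zero [] {m = m} {R = R} {D} (westInvariant g _ _ _ av) _ count =
  R ++ D , subst (λ k → Grown _ k (R ++ D)) (trans (sym (+-identityʳ m)) count) g , av
westLoop-invariant zero    ((node _ , _) ∷ _) _ () _
westLoop-invariant (suc f) []                 _ () _
westLoop-invariant (suc f) ((node cs , p) ∷ st) {m = m} inv fuel count with westInvariant-pop inv
... | _ , _ , inv′ =
  westLoop-invariant f (pushed (2 + m) cs st) inv′
    (trans (suc-injective fuel) (sym (stackSize-pushed (2 + m) cs st)))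
    (trans (cong (suc m +_) (stackSize-pushed (2 + m) cs st)) (trans (sym (+-suc m _)) count))

-- The first iteration of westLoop, which labels the root, unfolds definitionally.
westpop-grown : ∀ cs → Σ[ w ∈ List ℕ ] Grown (westLoop (size (node cs)) ((node cs , 0) ∷ []) 1 []) (sizes cs) w
                                        × Avoids312 (1 ∷ w)
westpop-grown cs = westLoop-invariant (sizes cs) (pushed 1 cs []) initial (sym size≡) size≡
  where
  initial : WestInvariant 0 ((1 , 0) ∷ []) (pushed 1 cs []) [] []
  initial = westInvariant start [] (All-pushed cs (λ _ → here refl) []) (AllPairs-pushed cs [] [])
                          (avoids-singleton Pattern312 1)
  size≡ : stackSize (pushed 1 cs []) ≡ sizes cs
  size≡ = trans (stackSize-pushed 1 cs []) (+-identityʳ (sizes cs))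

mainTheorem8 : (T : PTree) →
    GammaInvSatisfies (size T) (eastpush T) Avoids213
    × GammaInvSatisfies (size T) (westpop T) Avoids312
mainTheorem8 (node cs) =
    grown⇒GammaInvSatisfies Avoids213 (eastpush-grown cs)
  , grown⇒GammaInvSatisfies Avoids312 (westpop-grown cs)
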